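{- Let $A_k=\{a_1,\dots,a_k\}$ with $1=a_1<a_2<\dots<a_k$ integers, and let $h_0$ be the smallest positive integer $h$ with $n(h)\ge a_k$. Then there exists an integer $h_1\ge h_0-1$ such that $n(h+1)=n(h)+a_k$ for all integers $h\ge h_1$.
   Context: For an integer $h\ge 0$, an integer $x\ge 0$ has an $h$-representation if $x=\sum_{i=1}^k c_ia_i$ with nonnegative integers $c_i$ and $\sum_i c_i\le h$. The $h$-range $n(h)$ is the largest integer $n$ such that every integer $0\le x\le n$ has an $h$-representation. -}

module Defs where

open import Data.Nat using (ℕ; zero; suc; _+_; _*_; _≤_; _<_)
open import Data.Fin using (Fin)
open import Data.Vec using (Vec; lookup; sum; zipWith)
open import Data.Product using (Σ; _×_; ∃)
open import Relation.Binary.PropositionalEquality using (_≡_)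
open import Relation.Nullary using (¬_)

-- The set A_k = {a_1,...,a_k} is given as a vector a : Vec ℕ k (index 0 = a_1).
-- It is a valid basis if 1 = a_1 < a_2 < ... < a_k.
IsBasis : {k : ℕ} → Vec ℕ (suc k) → Set
IsBasis {k} a = (lookup a Fin.zero ≡ 1) ×
  ((i j : Fin (suc k)) → Data.Fin._<_ i j → lookup a i < lookup a j)

HasRep : {k : ℕ} → Vec ℕ k → ℕ → ℕ → Set
HasRep {k} a h x =
  Σ (Vec ℕ k) λ c → (sum c ≤ h) × (sum (zipWith _*_ c a) ≡ x)

-- IsRange a h n : n is the h-range n(h), i.e. the largest n such that
-- every 0 ≤ x ≤ n has an h-representation.
IsRange : {k : ℕ} → Vec ℕ k → ℕ → ℕ → Set
IsRange a h n = ((x : ℕ) → x ≤ n → HasRep a h x) × ¬ HasRep a h (suc n)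

module Submission where

-- Let K = a_k be the largest element of the basis.  For every h ≥ K + K²,
-- the h-range grows by exactly K at the next step, n(h+1) = n(h) + K;
-- hence h₁ = K + K² + h₀ witnesses the theorem.
--
-- Lower bounds come from explicit coverings: since a₁ = 1, every x ≤ h has
-- an h-representation, and if [0, y] is h-covered with K ≤ y + 1, then
-- [0, y + K] is (h+1)-covered (add one copy of K).  Iterating gives that
-- [0, (t+1)K] is (K+t)-covered, so n(K+t) ≥ (t+1)K and n(h+1) ≥ n(h) + K.
--
-- The upper bound rests on a dichotomy for an (h+1)-representation of x:
-- either it avoids a_k, so x ≤ (h+1)(K-1) because every other a_i ≤ K-1,
-- or removing one copy of a_k yields an h-representation of x - K.  For
-- x = n(h) + K + 1 the first case is excluded by n(h) ≥ (t+1)K once t ≥ K²,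
-- and the second would give an h-representation of n(h) + 1.

open import Defs
open import Data.Nat using (ℕ; zero; suc; _+_; _∸_; _≤_; _<_)
open import Data.Fin using (Fin; fromℕ)
open import Data.Vec using (Vec; lookup)
open import Data.Product using (Σ; _×_)
open import Relation.Binary.PropositionalEquality using (_≡_)

open import Data.Nat using (_*_; pred; z≤n; s≤s; _≤?_)
open import Data.Nat.Properties
open import Data.Nat.Solver using (module +-*-Solver)
open import Data.Vec using ([]; _∷_; sum; zipWith; replicate)
open import Data.Product using (_,_; proj₁; proj₂)
open import Data.Sum using (_⊎_; inj₁; inj₂)
import Data.Fin as F
import Data.Fin.Properties as FP
open import Relation.Binary.PropositionalEquality
  using (refl; sym; trans; cong; cong₂; subst; subst₂; module ≡-Reasoning)
open import Relation.Nullary using (yes; no; ¬_; contradiction)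

value : {k : ℕ} → Vec ℕ k → Vec ℕ k → ℕ
value c a = sum (zipWith _*_ c a)

largest : {k : ℕ} → Vec ℕ (suc k) → ℕ
largest {k} a = lookup a (fromℕ k)

bumpLast : {k : ℕ} → Vec ℕ (suc k) → Vec ℕ (suc k)
bumpLast {zero} (x ∷ []) = suc x ∷ []
bumpLast {suc k} (x ∷ c) = x ∷ bumpLast c

sum-bumpLast : {k : ℕ} (c : Vec ℕ (suc k)) → sum (bumpLast c) ≡ suc (sum c)
sum-bumpLast {zero} (x ∷ []) = refl
sum-bumpLast {suc k} (x ∷ c) = trans (cong (x +_) (sum-bumpLast c)) (+-suc x (sum c))

value-bumpLast : {k : ℕ} (c a : Vec ℕ (suc k)) →
  value (bumpLast c) a ≡ value c a + largest a
value-bumpLast {zero} (x ∷ []) (y ∷ []) = begin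
    (y + x * y) + 0    ≡⟨ +-identityʳ _ ⟩
    y + x * y          ≡⟨ +-comm y (x * y) ⟩
    x * y + y          ≡⟨ cong (_+ y) (sym (+-identityʳ (x * y))) ⟩
    (x * y + 0) + y    ∎
  where open ≡-Reasoning
value-bumpLast {suc k} (x ∷ c) (y ∷ a) =
  trans (cong (x * y +_) (value-bumpLast c a)) (sym (+-assoc (x * y) (value c a) _))

unbumpLast : {k : ℕ} (c : Vec ℕ (suc k)) {j : ℕ} → lookup c (fromℕ k) ≡ suc j →
  Σ (Vec ℕ (suc k)) λ c′ → c ≡ bumpLast c′
unbumpLast {zero} (.(suc _) ∷ []) refl = (_ ∷ []) , refl
unbumpLast {suc k} (x ∷ c) last≡ with unbumpLast c last≡
... | c′ , refl = (x ∷ c′) , refl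

sum-zeros : (k : ℕ) → sum (replicate k 0) ≡ 0
sum-zeros zero = refl
sum-zeros (suc k) = sum-zeros k

value-zeros : {k : ℕ} (a : Vec ℕ k) → value (replicate k 0) a ≡ 0
value-zeros [] = refl
value-zeros (y ∷ a) = value-zeros a

value-avoiding-last : {k : ℕ} (c a : Vec ℕ (suc k)) (B : ℕ) →
  ((i : Fin k) → lookup a (F.inject₁ i) ≤ B) →
  lookup c (fromℕ k) ≡ 0 → value c a ≤ sum c * B
value-avoiding-last {zero} (.0 ∷ []) (y ∷ []) B _ refl = z≤n
value-avoiding-last {suc k} (x ∷ c) (y ∷ a) B small last≡0 = begin
    x * y + value c a
  ≤⟨ +-mono-≤ (*-monoʳ-≤ x (small F.zero))
               (value-avoiding-last c a B (λ i → small (F.suc i)) last≡0) ⟩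
    x * B + sum c * B
  ≡⟨ sym (*-distribʳ-+ B x (sum c)) ⟩
    (x + sum c) * B ∎
  where open ≤-Reasoning

rep-weaken : {k : ℕ} (a : Vec ℕ k) {h x : ℕ} → HasRep a h x → HasRep a (suc h) x
rep-weaken a (c , s , v) = c , m≤n⇒m≤1+n s , v

Covers : {k : ℕ} → Vec ℕ k → ℕ → ℕ → Set
Covers a h y = (x : ℕ) → x ≤ y → HasRep a h x

covers-ones : {k : ℕ} (a : Vec ℕ (suc k)) → lookup a F.zero ≡ 1 → (h : ℕ) → Covers a h h
covers-ones {k} (y ∷ a) refl h x x≤h =
  (x ∷ replicate k 0) ,
  subst (_≤ h) (sym (trans (cong (x +_) (sum-zeros k)) (+-identityʳ x))) x≤h ,
  trans (cong₂ _+_ (*-identityʳ x) (value-zeros a)) (+-identityʳ x)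

covers-step : {k : ℕ} (a : Vec ℕ (suc k)) {h y : ℕ} → Covers a h y →
  largest a ≤ suc y → Covers a (suc h) (y + largest a)
covers-step a {h} {y} cov K≤1+y x x≤y+K with x ≤? y
... | yes x≤y = rep-weaken a (cov x x≤y)
... | no x≰y with cov (x ∸ largest a) (m≤n+o⇒m∸n≤o x _ (subst (x ≤_) (+-comm y _) x≤y+K))
... | c , s , v =
  bumpLast c ,
  subst (_≤ suc h) (sym (sum-bumpLast c)) (s≤s s) ,
  trans (value-bumpLast c a)
        (trans (cong (_+ largest a) v) (m∸n+n≡m (≤-trans K≤1+y (≰⇒> x≰y))))

covers-multiple : {k : ℕ} (a : Vec ℕ (suc k)) → lookup a F.zero ≡ 1 → (t : ℕ) →
  Covers a (largest a + t) (suc t * largest a)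
covers-multiple a a₁≡1 zero = covers-ones a a₁≡1 _
covers-multiple a a₁≡1 (suc t) x x≤ =
  subst (λ h → HasRep a h x) (sym (+-suc K t))
    (covers-step a (covers-multiple a a₁≡1 t) (m≤n⇒m≤1+n (m≤m+n K (t * K))) x
      (≤-trans x≤ (≤-reflexive (+-comm K (suc t * K)))))
  where K = largest a

last-dichotomy : {k : ℕ} (a : Vec ℕ (suc k)) (B : ℕ) →
  ((i : Fin k) → lookup a (F.inject₁ i) ≤ B) → {h x : ℕ} → HasRep a (suc h) x →
  (x ≤ suc h * B) ⊎ (Σ ℕ λ x′ → (x ≡ x′ + largest a) × HasRep a h x′)
last-dichotomy {k} a B small {h} (c , s , v) with lookup c (fromℕ k) in last≡
... | zero = inj₁ (subst (_≤ suc h * B) v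
                    (≤-trans (value-avoiding-last c a B small last≡) (*-monoˡ-≤ B s)))
... | suc _ with unbumpLast c last≡
... | c′ , refl = inj₂ (value c′ a ,
                        trans (sym v) (value-bumpLast c′ a) ,
                        c′ , ≤-pred (subst (_≤ suc h) (sum-bumpLast c′) s) , refl)

below-largest : {k : ℕ} (a : Vec ℕ (suc k)) → IsBasis a →
  (i : Fin k) → lookup a (F.inject₁ i) ≤ pred (largest a)
below-largest {k} a (_ , increasing) i = <⇒≤pred (increasing (F.inject₁ i) (fromℕ k)
  (subst₂ _<_ (sym (FP.toℕ-inject₁ i)) (sym (FP.toℕ-fromℕ k)) (FP.toℕ<n i)))

range-lower : {k : ℕ} (a : Vec ℕ k) {h m y : ℕ} → IsRange a h m → Covers a h y → y ≤ m
range-lower a {m = m} {y} (_ , gap) cov with y ≤? m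
... | yes y≤m = y≤m
... | no y≰m = contradiction (cov (suc m) (≰⇒> y≰m)) gap

range-upper : {k : ℕ} (a : Vec ℕ k) {h m y : ℕ} → IsRange a h m → ¬ HasRep a h (suc y) → m ≤ y
range-upper a {m = m} {y} (cov , _) no-rep with m ≤? y
... | yes m≤y = m≤y
... | no m≰y = contradiction (cov (suc y) (≰⇒> m≰y)) no-rep

-- Arithmetic core of the upper bound: for t ≥ K², a number avoiding a_k and
-- using at most K + t + 1 summands, each ≤ K - 1, is at most (t+1)K + K.
avoiding-bound : (K t : ℕ) → K * K ≤ t → suc (K + t) * pred K ≤ suc t * K + K
avoiding-bound zero t _ = ≤-trans (≤-reflexive (*-zeroʳ (suc t))) z≤n
avoiding-bound (suc p) t K²≤t = begin
    suc (suc p + t) * p                               ≡⟨ cong (λ t → suc (suc p + t) * p) t≡ ⟩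
    suc (suc p + (suc p * suc p + u)) * p             ≤⟨ m≤m+n _ (p + p + u + 3) ⟩
    suc (suc p + (suc p * suc p + u)) * p + (p + p + u + 3)
                                                      ≡⟨ identity p u ⟩
    suc (suc p * suc p + u) * suc p + suc p           ≡⟨ cong (λ t → suc t * suc p + suc p) (sym t≡) ⟩
    suc t * suc p + suc p                             ∎
  where
  open ≤-Reasoning
  u = t ∸ suc p * suc p
  t≡ : t ≡ suc p * suc p + u
  t≡ = sym (m+[n∸m]≡n K²≤t)
  identity : (p u : ℕ) → suc (suc p + (suc p * suc p + u)) * p + (p + p + u + 3)
                          ≡ suc (suc p * suc p + u) * suc p + suc p
  identity = solve 2 (λ p u →
      (con 1 :+ (con 1 :+ p :+ ((con 1 :+ p) :* (con 1 :+ p) :+ u))) :* p :+ (p :+ p :+ u :+ con 3)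
    := (con 1 :+ ((con 1 :+ p) :* (con 1 :+ p) :+ u)) :* (con 1 :+ p) :+ (con 1 :+ p)) refl
    where open +-*-Solver

range-additive : {k : ℕ} (a : Vec ℕ (suc k)) → IsBasis a → (t : ℕ) → largest a * largest a ≤ t →
  {m m′ : ℕ} → IsRange a (largest a + t) m → IsRange a (suc (largest a + t)) m′ →
  m′ ≡ m + largest a
range-additive a basis@(a₁≡1 , _) t K²≤t {m} {m′} range range′ = ≤-antisym upper lower
  where
  K = largest a
  multiple≤m : suc t * K ≤ m
  multiple≤m = range-lower a range (covers-multiple a a₁≡1 t)
  K≤1+m : K ≤ suc m
  K≤1+m = ≤-trans (m≤m+n K (t * K)) (m≤n⇒m≤1+n multiple≤m)
  lower : m + K ≤ m′
  lower = range-lower a range′ (covers-step a (proj₁ range) K≤1+m)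
  no-rep : ¬ HasRep a (suc (K + t)) (suc (m + K))
  no-rep rep with last-dichotomy a (pred K) (below-largest a basis) rep
  ... | inj₁ small = <-irrefl refl (≤-trans small
          (≤-trans (avoiding-bound K t K²≤t) (+-monoˡ-≤ K multiple≤m)))
  ... | inj₂ (x′ , x≡ , rep′) =
          proj₂ range (subst (HasRep a (K + t)) (+-cancelʳ-≡ K x′ (suc m) (sym x≡)) rep′)
  upper : m′ ≤ m + K
  upper = range-upper a range′ no-rep

theorem2 : (k : ℕ) (a : Vec ℕ (suc k)) → IsBasis a →
    (h₀ : ℕ) → 1 ≤ h₀ →
    ((n : ℕ) → IsRange a h₀ n → lookup a (fromℕ k) ≤ n) →
    ((h n : ℕ) → 1 ≤ h → h < h₀ → IsRange a h n → n < lookup a (fromℕ k)) →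
    Σ ℕ λ h₁ → (h₀ ∸ 1 ≤ h₁) ×
      ((h m m′ : ℕ) → h₁ ≤ h → IsRange a h m → IsRange a (suc h) m′ →
        m′ ≡ m + lookup a (fromℕ k))
theorem2 k a basis h₀ _ _ _ = h₁ , h₀-1≤h₁ , eventually-additive
  where
  K = largest a
  h₁ = K + (K * K + h₀)
  h₀-1≤h₁ : h₀ ∸ 1 ≤ h₁
  h₀-1≤h₁ = ≤-trans (m∸n≤m h₀ 1) (≤-trans (m≤n+m h₀ (K * K)) (m≤n+m _ K))
  eventually-additive : (h m m′ : ℕ) → h₁ ≤ h → IsRange a h m → IsRange a (suc h) m′ →
    m′ ≡ m + K
  eventually-additive h m m′ h₁≤h range range′ =
    range-additive a basis t K²≤t
      (subst (λ h → IsRange a h m) (sym h≡) range)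
      (subst (λ h → IsRange a (suc h) m′) (sym h≡) range′)
    where
    t = h ∸ K
    h≡ : K + t ≡ h
    h≡ = m+[n∸m]≡n (≤-trans (m≤m+n K _) h₁≤h)
    K²≤t : K * K ≤ t
    K²≤t = ≤-trans (m≤m+n (K * K) h₀) (subst (_≤ t) (m+n∸m≡n K _) (∸-monoˡ-≤ K h₁≤h))
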